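{- Let $\pi,\sigma\in S_n$ with $\mathrm{minimal}(\pi,\sigma)=m$. For each $k$ with $m\le k\le n$, the number of $c\in\mathcal{C}_{n,k}$ such that $\pi\circ\alpha_c=\sigma$ (equivalently, the number $f(D_\pi,D_\sigma,k)$ of $k$-colourings of $D_\pi$ whose reconstruction is $D_\sigma$) equals $\binom{n-m}{k-m}$.
   Context: $\mathcal{C}_{n,k}$ is the set of sequences $(c(1),\dots,c(n))$ with $\{c(1),\dots,c(n)\}=\{1,\dots,k\}$. For $c\in\mathcal{C}_{n,k}$, $\alpha_c$ is the lexicographically smallest permutation of $\{1,\dots,n\}$ with $c(\alpha_c(1))\le\cdots\le c(\alpha_c(n))$. For $\pi,\sigma\in S_n$ (as words $\pi(1)\cdots\pi(n)$), $\mathrm{minimal}(\pi,\sigma)$ is the number of left-to-right passes through $\pi$ needed to read off the letters $\sigma(1),\sigma(2),\dots,\sigma(n)$ in this order; equivalently $\mathrm{minimal}(\pi,\sigma)=1+|\{1\le j<n:\pi^{ -1}(\sigma(j+1))<\pi^{ -1}(\sigma(j))\}|$. For context: $D_\pi=\{e_i=(\pi(i),n+1,1,i):1\le i\le n\}$ is the web diagram on $n+1$ pegs whose edge $e_i$ joins peg $\pi(i)$ (height 1) to peg $n+1$ (height $i$), and colouring edge $e_i$ by $c(i)$ reconstructs $D_\pi$ into $D_{\pi\circ\alpha_c}$. -}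

module Defs where

open import Data.Nat as ℕ using (ℕ; zero; suc)
open import Data.Fin using (Fin; zero; suc; inject₁; _<_; _≤_; _<?_)
open import Data.Fin.Permutation using (Permutation′; _⟨$⟩ʳ_; _⟨$⟩ˡ_)
open import Data.Vec using (Vec; lookup)
open import Data.List using (List; length; filter; allFin)
open import Data.List.Membership.Propositional using (_∈_)
open import Data.List.Relation.Unary.Unique.Propositional using (Unique)
open import Data.Product using (Σ; ∃; _×_; _,_)
open import Data.Sum using (_⊎_)
open import Function.Bundles using (_⇔_)
open import Relation.Binary.PropositionalEquality using (_≡_)

-- Permutations of {1..n} are represented as permutations of Fin n (0-indexed);
-- the word of π is π(0) π(1) ... π(n-1), with π(i) = π ⟨$⟩ʳ i.

minimal : ∀ {n} → Permutation′ n → Permutation′ n → ℕ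
minimal {zero}  π σ = 1
minimal {suc n} π σ =
  suc (length (filter (λ (j : Fin n) →
         (π ⟨$⟩ˡ (σ ⟨$⟩ʳ suc j)) <? (π ⟨$⟩ˡ (σ ⟨$⟩ʳ inject₁ j)))
       (allFin n)))

InC : ∀ {n k} → Vec (Fin k) n → Set
InC {n} {k} c = ∀ (j : Fin k) → ∃ λ (i : Fin n) → lookup c i ≡ j

SortsBy : ∀ {n k} → Vec (Fin k) n → Permutation′ n → Set
SortsBy c α = ∀ i j → i ≤ j → lookup c (α ⟨$⟩ʳ i) ≤ lookup c (α ⟨$⟩ʳ j)

LexLeq : ∀ {n} → Permutation′ n → Permutation′ n → Set
LexLeq {n} α β =
  (∀ i → α ⟨$⟩ʳ i ≡ β ⟨$⟩ʳ i)
  ⊎ (∃ λ (i : Fin n) → (∀ j → j < i → α ⟨$⟩ʳ j ≡ β ⟨$⟩ʳ j) × (α ⟨$⟩ʳ i < β ⟨$⟩ʳ i))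

IsAlpha : ∀ {n k} → Vec (Fin k) n → Permutation′ n → Set
IsAlpha c α = SortsBy c α × (∀ β → SortsBy c β → LexLeq α β)

-- "the number of x : A with P x is N": an explicit duplicate-free list of
-- length N containing exactly the x satisfying P.
HasCount : {A : Set} → (A → Set) → ℕ → Set
HasCount {A} P N = Σ (List A) λ xs → Unique xs × length xs ≡ N × (∀ x → (x ∈ xs) ⇔ P x)

module Submission where

-- Put τ = π⁻¹ ∘ σ.  Since π ∘ α = σ forces α = τ, we must
-- count the onto colourings c : Fin n → Fin k whose lexicographically least
-- sorting permutation is τ.  Read c in the order τ: the levels
-- s(i) = c(τ(i)) then form a "staircase": they rise from 0 to k-1 in steps
-- of 0 or 1, and a step of 0 is impossible at a descent of the word τ
-- (otherwise swapping the two positions would give a lexicographically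
-- smaller sorting permutation).  Conversely every such staircase comes from
-- exactly one colouring with α_c = τ.  A staircase over the n-1 steps, with
-- the d = minimal π σ - 1 descent steps forced to rise and k-1 rises in
-- total, amounts to choosing the k-1-d remaining rises among the n-1-d free
-- steps, giving C(n-m, k-m).

open import Defs
open import Data.Nat using (ℕ; zero; suc; _≤_; _<_; _∸_; _+_; z≤n; s≤s; z<s; s<s; s≤s⁻¹; _≤?_)
import Data.Nat.Properties as ℕP
open import Data.Nat.Combinatorics using (_C_; nCk+nC[k+1]≡[n+1]C[k+1])
open import Data.Bool using (Bool; true; false)
open import Data.Fin as F using (Fin; zero; suc; toℕ; inject₁; fromℕ; fromℕ<; inject; _<?_)
import Data.Fin.Properties as FP
open import Data.Fin.Permutation using (Permutation′; _⟨$⟩ʳ_; _⟨$⟩ˡ_; _∘ₚ_; flip; transpose; inverseˡ; inverseʳ)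
import Data.Fin.Permutation.Components as PC
open import Data.Vec as V using (Vec; []; _∷_; lookup; tabulate)
open import Data.Vec.Properties using (∷-injectiveˡ; ∷-injectiveʳ; lookup-map; lookup∘tabulate; tabulate∘lookup; tabulate-cong)
open import Data.List as L using (List; []; _∷_; length; _++_; filter)
open import Data.List.Properties using (length-map; length-++)
open import Data.List.Membership.Propositional using (_∈_)
open import Data.List.Membership.Propositional.Properties using (∈-map⁻; ∈-map⁺; ∈-++⁻; ∈-++⁺ˡ; ∈-++⁺ʳ)
open import Data.List.Relation.Unary.Any using (here)
open import Data.List.Relation.Unary.Unique.Propositional using (Unique)
import Data.List.Relation.Unary.Unique.Propositional.Properties as Unique
open import Data.List.Relation.Unary.AllPairs using ([]; _∷_)
open import Data.List.Relation.Unary.All using ([])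
open import Data.Product using (∃; _×_; _,_; proj₁)
open import Data.Sum using (_⊎_; inj₁; inj₂)
open import Data.Empty using (⊥-elim)
open import Function using (_∘_; id)
open import Function.Bundles using (_⇔_; mk⇔; Equivalence)
open import Relation.Nullary using (¬_; Dec; yes; no; does)
open import Relation.Nullary.Decidable using (dec-false)
open import Relation.Unary using (Decidable)
open import Relation.Binary using (tri<; tri≈; tri>)
open import Relation.Binary.PropositionalEquality

countTrue : ∀ {N} → (Fin N → Bool) → ℕ
countTrue {zero}  f = 0
countTrue {suc N} f with f zero
... | true  = suc (countTrue (f ∘ suc))
... | false = countTrue (f ∘ suc)

countTrue≤ : ∀ {N} (f : Fin N → Bool) → countTrue f ≤ N
countTrue≤ {zero}  f = z≤n
countTrue≤ {suc N} f with f zero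
... | true  = s≤s (countTrue≤ (f ∘ suc))
... | false = ℕP.m≤n⇒m≤1+n (countTrue≤ (f ∘ suc))

length-filter-tabulate : ∀ {N} {A : Set} {Q : A → Set} (Q? : Decidable Q) (g : Fin N → A) →
  length (filter Q? (L.tabulate g)) ≡ countTrue (λ i → does (Q? (g i)))
length-filter-tabulate {zero}  Q? g = refl
length-filter-tabulate {suc N} Q? g with does (Q? (g zero))
... | true  = cong suc (length-filter-tabulate Q? (g ∘ suc))
... | false = length-filter-tabulate Q? (g ∘ suc)

-- Staircases

Step : Bool → ℕ → ℕ → Set
Step forced a b = (forced ≡ false × b ≡ a) ⊎ b ≡ suc a

Steps : ∀ {N} → (Fin N → Bool) → (Fin (suc N) → ℕ) → Set
Steps f s = ∀ j → Step (f j) (s (inject₁ j)) (s (suc j))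

Staircase : ∀ N → ℕ → (Fin N → Bool) → (Fin (suc N) → ℕ) → Set
Staircase N K f s = s zero ≡ 0 × s (fromℕ N) ≡ K × Steps f s

-- Non-decreasing sequences; SortsBy c τ says exactly that levels τ c is one.
Monotone : ∀ {n} → (Fin n → ℕ) → Set
Monotone s = ∀ i i' → i F.≤ i' → s i ≤ s i'

Step-≤ : ∀ {b x y} → Step b x y → x ≤ y
Step-≤ (inj₁ (_ , refl)) = ℕP.≤-refl
Step-≤ (inj₂ refl)       = ℕP.n≤1+n _

Step-≤1 : ∀ {b x y} → Step b x y → y ≤ suc x
Step-≤1 (inj₁ (_ , refl)) = ℕP.n≤1+n _
Step-≤1 (inj₂ refl)       = ℕP.≤-refl

Step-suc : ∀ {b x y} → Step b x y → Step b (suc x) (suc y)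
Step-suc (inj₁ (level , refl)) = inj₁ (level , refl)
Step-suc (inj₂ refl)           = inj₂ refl

Step-pred : ∀ {b x y} → Step b (suc x) (suc y) → Step b x y
Step-pred (inj₁ (level , refl)) = inj₁ (level , refl)
Step-pred (inj₂ refl)           = inj₂ refl

Steps-resp : ∀ {N} {f : Fin N → Bool} {s t : Fin (suc N) → ℕ} →
  (∀ i → s i ≡ t i) → Steps f s → Steps f t
Steps-resp s≗t st j = subst₂ (Step _) (s≗t (inject₁ j)) (s≗t (suc j)) (st j)

Staircase-resp : ∀ {N K} {f : Fin N → Bool} {s t : Fin (suc N) → ℕ} →
  (∀ i → s i ≡ t i) → Staircase N K f s → Staircase N K f t
Staircase-resp s≗t (start , end , st) =
  trans (sym (s≗t zero)) start , trans (sym (s≗t (fromℕ _))) end , Steps-resp s≗t st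

Steps-cons : ∀ {N} {f : Fin (suc N) → Bool} {s : Fin (suc (suc N)) → ℕ} →
  Step (f zero) (s zero) (s (suc zero)) → Steps (f ∘ suc) (s ∘ suc) → Steps f s
Steps-cons first rest zero    = first
Steps-cons first rest (suc j) = rest j

steps-monotone : ∀ {N} {f : Fin N → Bool} {s} → Steps f s → Monotone s
steps-monotone                 st zero    zero     _         = ℕP.≤-refl
steps-monotone {suc N} {f} {s} st zero    (suc i') _         =
  ℕP.≤-trans (Step-≤ (st zero)) (steps-monotone {N} {f ∘ suc} {s ∘ suc} (st ∘ suc) zero i' z≤n)
steps-monotone {suc N} {f} {s} st (suc i) (suc i') (s≤s i≤i') =
  steps-monotone {N} {f ∘ suc} {s ∘ suc} (st ∘ suc) i i' i≤i'

steps-surjective : ∀ {N} {f : Fin N → Bool} {s} → Steps f s →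
  ∀ v → s zero ≤ v → v ≤ s (fromℕ N) → ∃ λ i → s i ≡ v
steps-surjective {zero}          st v lo hi = zero , ℕP.≤-antisym lo hi
steps-surjective {suc N} {f} {s} st v lo hi with s zero ℕP.≟ v
... | yes s₀≡v = zero , s₀≡v
... | no  s₀≢v =
  let (i , sᵢ≡v) = steps-surjective {N} {f ∘ suc} {s ∘ suc} (st ∘ suc) v
                     (ℕP.≤-trans (Step-≤1 (st zero)) (ℕP.≤∧≢⇒< lo s₀≢v)) hi
  in suc i , sᵢ≡v

first-step-level : ∀ {N} {f : Fin (suc N) → Bool} {s} → Steps f s →
  ∀ b → s zero ≡ s (suc b) → f zero ≡ false × s (suc zero) ≡ s zero
first-step-level {N} {f} {s} st b s₀≡sb with st zero
... | inj₁ level = level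
... | inj₂ rise  = ⊥-elim (ℕP.1+n≰n (begin
  suc (s zero)   ≡⟨ sym rise ⟩
  s (suc zero)   ≤⟨ steps-monotone {f = f} {s = s} st (suc zero) (suc b) (s≤s z≤n) ⟩
  s (suc b)      ≡⟨ sym s₀≡sb ⟩
  s zero         ∎))
  where open ℕP.≤-Reasoning

level-ascending : ∀ {N} {f : Fin N → Bool} {s} (T : Fin (suc N) → ℕ) → Steps f s →
  (∀ j → f j ≡ false → T (inject₁ j) < T (suc j)) →
  ∀ i i' → i F.< i' → s i ≡ s i' → T i < T i'
level-ascending {f = f} {s} T st asc zero (suc zero) _ s₀≡s₁ =
  asc zero (proj₁ (first-step-level {f = f} {s = s} st zero s₀≡s₁))
level-ascending {suc N} {f} {s} T st asc zero (suc (suc b)) _ s₀≡s =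
  let (level , s₁≡s₀) = first-step-level {f = f} {s = s} st (suc b) s₀≡s
  in ℕP.<-trans (asc zero level)
       (level-ascending {N} {f ∘ suc} {s ∘ suc} (T ∘ suc) (st ∘ suc) (asc ∘ suc)
          zero (suc b) z<s (trans s₁≡s₀ s₀≡s))
level-ascending {suc N} {f} {s} T st asc (suc i) (suc i') (s<s i<i') sᵢ≡sᵢ' =
  level-ascending {N} {f ∘ suc} {s ∘ suc} (T ∘ suc) (st ∘ suc) (asc ∘ suc) i i' i<i' sᵢ≡sᵢ'

-- Explicit enumeration of staircases

heights : ∀ {K n} → Vec (Fin K) n → Fin n → ℕ
heights d i = toℕ (lookup d i)

heights-map-suc : ∀ {K n} (v : Vec (Fin K) n) i → heights (V.map F.suc v) i ≡ suc (heights v i)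
heights-map-suc v i = cong toℕ (lookup-map i F.suc v)

map-suc-injective : ∀ {K n} {u w : Vec (Fin K) n} → V.map F.suc u ≡ V.map F.suc w → u ≡ w
map-suc-injective {u = []}    {[]}    _ = refl
map-suc-injective {u = x ∷ u} {y ∷ w} e =
  cong₂ _∷_ (FP.suc-injective (∷-injectiveˡ e)) (map-suc-injective (∷-injectiveʳ e))

lower : ∀ {K n} (w : Vec (Fin (suc K)) n) → (∀ i → 0 < heights w i) → ∃ λ v → w ≡ V.map F.suc v
lower []          _   = [] , refl
lower (zero ∷ w)  pos = ⊥-elim (ℕP.n≮n 0 (pos zero))
lower (suc x ∷ w) pos = let (v , w≡) = lower w (pos ∘ suc) in x ∷ v , cong (suc x ∷_) w≡

-- stairs N K f lists the vectors whose heights form a staircase of height K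
-- over f: after the initial 0, either stay level (if the first step is not
-- forced) or rise, continuing with the remaining mask.  rises N K g lists
-- those whose first step is a rise: 0 followed by a staircase shifted up by one.
mutual
  stairs : (N K : ℕ) → (Fin N → Bool) → List (Vec (Fin (suc K)) (suc N))
  stairs zero    zero    f = (zero ∷ []) ∷ []
  stairs zero    (suc K) f = []
  stairs (suc N) K       f with f zero
  ... | true  = rises N K (f ∘ suc)
  ... | false = L.map (zero ∷_) (stairs N K (f ∘ suc)) ++ rises N K (f ∘ suc)

  rises : (N K : ℕ) → (Fin N → Bool) → List (Vec (Fin (suc K)) (suc (suc N)))
  rises N zero    g = []
  rises N (suc K) g = L.map (λ v → zero ∷ V.map F.suc v) (stairs N K g)

level-first-step : ∀ {N K} {f : Fin (suc N) → Bool} (v : Vec (Fin (suc K)) (suc N)) →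
  f zero ≡ false → Staircase N K (f ∘ suc) (heights v) → Staircase (suc N) K f (heights (zero ∷ v))
level-first-step {f = f} v level (start , end , st) =
  refl , end , Steps-cons {f = f} {s = heights (zero ∷ v)} (inj₁ (level , start)) st

rising-first-step : ∀ {N K} {f : Fin (suc N) → Bool} (v : Vec (Fin (suc K)) (suc N)) →
  Staircase N K (f ∘ suc) (heights v) →
  Staircase (suc N) (suc K) f (heights (zero ∷ V.map F.suc v))
rising-first-step {N} {f = f} v (start , end , st) =
  refl ,
  trans (heights-map-suc v (fromℕ N)) (cong suc end) ,
  Steps-cons {f = f} {s = heights (zero ∷ V.map F.suc v)}
    (inj₂ (trans (heights-map-suc v zero) (cong suc start)))
    (Steps-resp (sym ∘ heights-map-suc v) (Step-suc ∘ st))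

mutual
  stairs-sound : ∀ {N K f} (d : Vec (Fin (suc K)) (suc N)) →
    d ∈ stairs N K f → Staircase N K f (heights d)
  stairs-sound {zero} {zero} _ (here refl) = refl , refl , λ ()
  stairs-sound {suc N} {K} {f} d d∈ with f zero in f₀
  ... | true  = rises-sound f d d∈
  ... | false with ∈-++⁻ (L.map (zero ∷_) (stairs N K (f ∘ suc))) d∈
  ...   | inj₂ d∈rises = rises-sound f d d∈rises
  ...   | inj₁ d∈level with ∈-map⁻ (zero ∷_) d∈level
  ...     | v , v∈ , refl = level-first-step v f₀ (stairs-sound v v∈)

  rises-sound : ∀ {N K} (f : Fin (suc N) → Bool) (d : Vec (Fin (suc K)) (suc (suc N))) →
    d ∈ rises N K (f ∘ suc) → Staircase (suc N) K f (heights d)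
  rises-sound {N} {suc K} f d d∈ with ∈-map⁻ (λ v → zero ∷ V.map F.suc v) d∈
  ... | v , v∈ , refl = rising-first-step v (stairs-sound v v∈)

mutual
  stairs-complete : ∀ {N K f} (d : Vec (Fin (suc K)) (suc N)) →
    Staircase N K f (heights d) → d ∈ stairs N K f
  stairs-complete (suc _ ∷ _) (() , _)
  stairs-complete {zero} {zero}  (zero ∷ []) _ = here refl
  stairs-complete {zero} {suc K} (zero ∷ []) (_ , () , _)
  stairs-complete {suc N} {K} {f} (zero ∷ w) (_ , end , st) with f zero | st zero
  ... | true  | inj₁ (() , _)
  ... | true  | inj₂ w₀≡1 = rises-complete w w₀≡1 end (st ∘ suc)
  ... | false | inj₂ w₀≡1 =
    ∈-++⁺ʳ (L.map (zero ∷_) (stairs N K (f ∘ suc))) (rises-complete w w₀≡1 end (st ∘ suc))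
  ... | false | inj₁ (_ , w₀≡0) =
    ∈-++⁺ˡ (∈-map⁺ (zero ∷_) (stairs-complete w (w₀≡0 , end , st ∘ suc)))

  -- A staircase from height 1 is a shifted staircase from 0: all its
  -- heights are positive, so it can be lowered by one.
  rises-complete : ∀ {N K} {g : Fin N → Bool} (w : Vec (Fin (suc K)) (suc N)) →
    heights w zero ≡ 1 → heights w (fromℕ N) ≡ K → Steps g (heights w) →
    (zero ∷ w) ∈ rises N K g
  rises-complete {K = zero} w w₀≡1 _ _ =
    ⊥-elim (ℕP.n≮n 1 (subst (_< 1) w₀≡1 (FP.toℕ<n (lookup w zero))))
  rises-complete {N} {suc K} {g} w w₀≡1 end st
    with lower w (λ i → ℕP.≤-trans (ℕP.≤-reflexive (sym w₀≡1))
                          (steps-monotone {f = g} {s = heights w} st zero i z≤n))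
  ... | v , refl =
    ∈-map⁺ (λ v → zero ∷ V.map F.suc v) (stairs-complete v (start , end′ , st′))
    where
    start : heights v zero ≡ 0
    start = ℕP.suc-injective (trans (sym (heights-map-suc v zero)) w₀≡1)
    end′ : heights v (fromℕ N) ≡ K
    end′ = ℕP.suc-injective (trans (sym (heights-map-suc v (fromℕ N))) end)
    st′ : Steps g (heights v)
    st′ j = Step-pred (Steps-resp (heights-map-suc v) st j)

stairs-spec : ∀ {N K f} (d : Vec (Fin (suc K)) (suc N)) →
  d ∈ stairs N K f ⇔ Staircase N K f (heights d)
stairs-spec d = mk⇔ (stairs-sound d) (stairs-complete d)

level-rise-disjoint : ∀ {N K g} {d : Vec (Fin (suc K)) (suc (suc N))} →
  ¬ (d ∈ L.map (zero ∷_) (stairs N K g) × d ∈ rises N K g)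
level-rise-disjoint {K = zero} (_ , ())
level-rise-disjoint {N} {suc K} {g} (d∈level , d∈rises)
  with ∈-map⁻ (zero ∷_) d∈level | ∈-map⁻ (λ v → zero ∷ V.map F.suc v) d∈rises
... | v , v∈ , refl | u , _ , v≡ = ℕP.1+n≢0 (begin
  suc (heights u zero)         ≡⟨ sym (heights-map-suc u zero) ⟩
  heights (V.map F.suc u) zero   ≡⟨ cong (λ w → heights w zero) (sym (∷-injectiveʳ v≡)) ⟩
  heights v zero               ≡⟨ proj₁ (stairs-sound v v∈) ⟩
  0                            ∎)
  where open ≡-Reasoning

mutual
  stairs-unique : ∀ {N K f} → Unique (stairs N K f)
  stairs-unique {zero}  {zero}  = [] ∷ []
  stairs-unique {zero}  {suc K} = []
  stairs-unique {suc N} {K} {f} with f zero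
  ... | true  = rises-unique
  ... | false = Unique.++⁺ (Unique.map⁺ ∷-injectiveʳ stairs-unique) rises-unique level-rise-disjoint

  rises-unique : ∀ {N K g} → Unique (rises N K g)
  rises-unique {K = zero}  = []
  rises-unique {K = suc K} = Unique.map⁺ (map-suc-injective ∘ ∷-injectiveʳ) stairs-unique

length-level-rise : ∀ N K (g : Fin N → Bool) →
  length (L.map (zero ∷_) (stairs N K g) ++ rises N K g) ≡ length (stairs N K g) + length (rises N K g)
length-level-rise N K g =
  trans (length-++ (L.map (zero ∷_) (stairs N K g))) (cong (_+ length (rises N K g)) (length-map (zero ∷_) (stairs N K g)))

length-rises : ∀ N K (g : Fin N → Bool) → length (rises N (suc K) g) ≡ length (stairs N K g)
length-rises N K g = length-map (λ v → zero ∷ V.map F.suc v) (stairs N K g)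

mutual
  stairs-empty : ∀ {N K} (f : Fin N → Bool) → K < countTrue f → length (stairs N K f) ≡ 0
  stairs-empty {zero}      f ()
  stairs-empty {suc N} {K} f K<c with f zero
  ... | true  = rises-empty (f ∘ suc) (s≤s⁻¹ K<c)
  ... | false = trans (length-level-rise N K (f ∘ suc))
                  (cong₂ _+_ (stairs-empty (f ∘ suc) K<c) (rises-empty (f ∘ suc) (ℕP.<⇒≤ K<c)))

  rises-empty : ∀ {N K} (g : Fin N → Bool) → K ≤ countTrue g → length (rises N K g) ≡ 0
  rises-empty {K = zero}  g _   = refl
  rises-empty {N} {suc K} g K<c = trans (length-rises N K g) (stairs-empty g K<c)

pascal-shifted : ∀ {N K c} → c ≤ K → c ≤ N →
  (N ∸ c) C (suc K ∸ c) + (N ∸ c) C (K ∸ c) ≡ (suc N ∸ c) C (suc K ∸ c)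
pascal-shifted {N} {K} {c} c≤K c≤N = begin
  (N ∸ c) C (suc K ∸ c) + (N ∸ c) C (K ∸ c)   ≡⟨ cong (λ x → (N ∸ c) C x + (N ∸ c) C (K ∸ c)) (ℕP.+-∸-assoc 1 c≤K) ⟩
  (N ∸ c) C suc (K ∸ c) + (N ∸ c) C (K ∸ c)   ≡⟨ ℕP.+-comm ((N ∸ c) C suc (K ∸ c)) _ ⟩
  (N ∸ c) C (K ∸ c) + (N ∸ c) C suc (K ∸ c)   ≡⟨ nCk+nC[k+1]≡[n+1]C[k+1] (N ∸ c) (K ∸ c) ⟩
  suc (N ∸ c) C suc (K ∸ c)                   ≡⟨ sym (cong₂ _C_ (ℕP.+-∸-assoc 1 c≤N) (ℕP.+-∸-assoc 1 c≤K)) ⟩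
  (suc N ∸ c) C (suc K ∸ c)                   ∎
  where open ≡-Reasoning

-- With c forced rises among N steps, a staircase of height K chooses its
-- remaining K - c rises among the N - c free steps.
stairs-length : ∀ {N K} (f : Fin N → Bool) → countTrue f ≤ K →
  length (stairs N K f) ≡ (N ∸ countTrue f) C (K ∸ countTrue f)
stairs-length {zero}  {zero}  f _ = refl
stairs-length {zero}  {suc K} f _ = refl
stairs-length {suc N} {K}     f c≤K with f zero
stairs-length {suc N} {suc K} f (s≤s c≤K) | true =
  trans (length-rises N K (f ∘ suc)) (stairs-length (f ∘ suc) c≤K)
stairs-length {suc N} {K} f c≤K | false with ℕP.m≤n⇒m<n∨m≡n c≤K
... | inj₂ refl = begin   -- here K = c, and m C 0 computes to 1
  length (L.map (zero ∷_) (stairs N c g) ++ rises N c g)  ≡⟨ length-level-rise N c g ⟩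
  length (stairs N c g) + length (rises N c g)             ≡⟨ cong₂ _+_ (stairs-length g ℕP.≤-refl) (rises-empty g ℕP.≤-refl) ⟩
  (N ∸ c) C (c ∸ c) + 0                                    ≡⟨ cong (λ x → (N ∸ c) C x + 0) (ℕP.n∸n≡0 c) ⟩
  1                                                        ≡⟨ cong ((suc N ∸ c) C_) (sym (ℕP.n∸n≡0 c)) ⟩
  (suc N ∸ c) C (c ∸ c)                                    ∎
  where
  open ≡-Reasoning
  g = f ∘ suc
  c = countTrue g
... | inj₁ (s≤s {n = K′} c≤K′) = begin
  length (L.map (zero ∷_) (stairs N (suc K′) g) ++ rises N (suc K′) g)
    ≡⟨ length-level-rise N (suc K′) g ⟩
  length (stairs N (suc K′) g) + length (rises N (suc K′) g)
    ≡⟨ cong₂ _+_ (stairs-length g (ℕP.m≤n⇒m≤1+n c≤K′)) (trans (length-rises N K′ g) (stairs-length g c≤K′)) ⟩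
  (N ∸ c) C (suc K′ ∸ c) + (N ∸ c) C (K′ ∸ c)
    ≡⟨ pascal-shifted c≤K′ (countTrue≤ g) ⟩
  (suc N ∸ c) C (suc K′ ∸ c)
    ∎
  where
  open ≡-Reasoning
  g = f ∘ suc
  c = countTrue g

-- Permutations

perm-injective : ∀ {n} (ρ : Permutation′ n) {i j} → ρ ⟨$⟩ʳ i ≡ ρ ⟨$⟩ʳ j → i ≡ j
perm-injective ρ {i} {j} ρi≡ρj =
  trans (sym (inverseˡ ρ)) (trans (cong (ρ ⟨$⟩ˡ_) ρi≡ρj) (inverseˡ ρ))

first-difference : ∀ {n m} (g h : Fin n → Fin m) →
  (∀ i → g i ≡ h i) ⊎ ∃ λ i → (∀ j → j F.< i → g j ≡ h j) × g i ≢ h i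
first-difference {n} g h with FP.all? (λ i → g i FP.≟ h i)
... | yes same = inj₁ same
... | no ¬same with FP.¬∀⟶∃¬-smallest n (λ i → g i ≡ h i) (λ i → g i FP.≟ h i) ¬same
...   | i , differ , below = inj₂ (i , agree , differ)
  where
  agree : ∀ j → j F.< i → g j ≡ h j
  agree j j<i = subst (λ x → g x ≡ h x) inject-j≡j (below (fromℕ< j<i))
    where
    inject-j≡j : inject (fromℕ< j<i) ≡ j
    inject-j≡j = FP.toℕ-injective (trans (FP.toℕ-inject (fromℕ< j<i)) (FP.toℕ-fromℕ< j<i))

later-occurrence : ∀ {n} (ρ ρ' : Permutation′ n) {i} →
  (∀ j → j F.< i → ρ ⟨$⟩ʳ j ≡ ρ' ⟨$⟩ʳ j) → ρ ⟨$⟩ʳ i ≢ ρ' ⟨$⟩ʳ i →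
  i F.< ρ ⟨$⟩ˡ (ρ' ⟨$⟩ʳ i)
later-occurrence ρ ρ' {i} agree differ with FP.<-cmp i (ρ ⟨$⟩ˡ (ρ' ⟨$⟩ʳ i))
... | tri< i<q _ _ = i<q
... | tri≈ _ i≡q _ = ⊥-elim (differ (trans (cong (ρ ⟨$⟩ʳ_) i≡q) (inverseʳ ρ)))
... | tri> _ _ q<i =
  ⊥-elim (FP.<-irrefl (perm-injective ρ' (trans (sym (agree _ q<i)) (inverseʳ ρ))) q<i)

transpose-left : ∀ {n} (a b : Fin n) → PC.transpose a b a ≡ b
transpose-left a b with a FP.≟ a
... | yes _   = refl
... | no  a≢a = ⊥-elim (a≢a refl)

transpose-elsewhere : ∀ {n} (a b x : Fin n) → x ≢ a → x ≢ b → PC.transpose a b x ≡ x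
transpose-elsewhere a b x x≢a x≢b with x FP.≟ a
... | yes x≡a = ⊥-elim (x≢a x≡a)
... | no  _ with x FP.≟ b
...   | yes x≡b = ⊥-elim (x≢b x≡b)
...   | no  _   = refl

transpose-preserves : ∀ {n} {A : Set} (g : Fin n → A) (a b : Fin n) → g a ≡ g b →
  ∀ x → g (PC.transpose a b x) ≡ g x
transpose-preserves g a b ga≡gb x with x FP.≟ a
... | yes refl = sym ga≡gb
... | no  _ with x FP.≟ b
...   | yes refl = ga≡gb
...   | no  _    = refl

IsAlpha-resp : ∀ {n k} {c : Vec (Fin k) n} {α α' : Permutation′ n} →
  (∀ i → α ⟨$⟩ʳ i ≡ α' ⟨$⟩ʳ i) → IsAlpha c α → IsAlpha c α'
IsAlpha-resp {c = c} {α} {α'} α≗α' (sorts , least) = sorts′ , λ β sβ → least′ β (least β sβ)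
  where
  colour≡ : ∀ i → lookup c (α ⟨$⟩ʳ i) ≡ lookup c (α' ⟨$⟩ʳ i)
  colour≡ i = cong (lookup c) (α≗α' i)
  sorts′ : SortsBy c α'
  sorts′ i j i≤j = subst₂ F._≤_ (colour≡ i) (colour≡ j) (sorts i j i≤j)
  least′ : ∀ β → LexLeq α β → LexLeq α' β
  least′ β (inj₁ same) = inj₁ (λ i → trans (sym (α≗α' i)) (same i))
  least′ β (inj₂ (i , agree , α<β)) =
    inj₂ (i , (λ j j<i → trans (sym (α≗α' j)) (agree j j<i)) , subst (F._< β ⟨$⟩ʳ i) (α≗α' i) α<β)

swap-sorts : ∀ {n k} (c : Vec (Fin k) n) (α : Permutation′ n) (a b : Fin n) →
  lookup c (α ⟨$⟩ʳ a) ≡ lookup c (α ⟨$⟩ʳ b) → SortsBy c α → SortsBy c (transpose a b ∘ₚ α)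
swap-sorts c α a b same sorts x y x≤y =
  subst₂ F._≤_ (sym (unchanged x)) (sym (unchanged y)) (sorts x y x≤y)
  where
  unchanged = transpose-preserves (lookup c ∘ (α ⟨$⟩ʳ_)) a b same

-- The least sorting permutation lists each colour class increasingly: two
-- positions a < b of equal colour are never inverted, for otherwise
-- swapping them would give a lexicographically smaller sorting permutation.
least-sorting-not-inverted : ∀ {n k} (c : Vec (Fin k) n) (α : Permutation′ n) → IsAlpha c α →
  ∀ {a b} → a F.< b → lookup c (α ⟨$⟩ʳ a) ≡ lookup c (α ⟨$⟩ʳ b) → ¬ (α ⟨$⟩ʳ b F.< α ⟨$⟩ʳ a)
least-sorting-not-inverted c α (sorts , least) {a} {b} a<b same inverted
  with least (transpose a b ∘ₚ α) (swap-sorts c α a b same sorts)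
... | inj₁ equal = a≢b (perm-injective α (trans (equal a) (cong (α ⟨$⟩ʳ_) (transpose-left a b))))
  where a≢b = FP.<⇒≢ a<b
... | inj₂ (i , agree , α<β) with FP.<-cmp i a
...   | tri< i<a _ _ =
  FP.<-irrefl (sym (cong (α ⟨$⟩ʳ_) (transpose-elsewhere a b i (FP.<⇒≢ i<a) (FP.<⇒≢ (FP.<-trans i<a a<b))))) α<β
...   | tri≈ _ refl _ =
  ℕP.<-asym inverted (subst (α ⟨$⟩ʳ a F.<_) (cong (α ⟨$⟩ʳ_) (transpose-left a b)) α<β)
...   | tri> _ _ a<i =
  FP.<⇒≢ a<b (perm-injective α (trans (agree a a<i) (cong (α ⟨$⟩ʳ_) (transpose-left a b))))

module _ {N K} {s : Fin (suc N) → ℕ} (mono : Monotone s)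
         (attains : ∀ v → v ≤ K → ∃ λ i → s i ≡ v) (bounded : ∀ i → s i ≤ K) where

  onto-start : s zero ≡ 0
  onto-start =
    let (i , sᵢ≡0) = attains 0 z≤n
    in ℕP.n≤0⇒n≡0 (subst (s zero ≤_) sᵢ≡0 (mono zero i z≤n))

  onto-end : s (fromℕ N) ≡ K
  onto-end =
    let (i , sᵢ≡K) = attains K ℕP.≤-refl
    in ℕP.≤-antisym (bounded (fromℕ N)) (subst (_≤ s (fromℕ N)) sᵢ≡K (mono i (fromℕ N) (FP.≤fromℕ i)))

  no-value-skipped : ∀ {j v} → s (inject₁ j) < v → v < s (suc j) → ¬ ∃ (λ i → s i ≡ v)
  no-value-skipped {j} below above (i , refl) with toℕ i ≤? toℕ (inject₁ j)
  ... | yes i≤j = ℕP.<⇒≱ below (mono i (inject₁ j) i≤j)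
  ... | no  i≰j = ℕP.<⇒≱ above (mono (suc j) i j<i)
    where
    j<i : suc j F.≤ i
    j<i = subst (_< toℕ i) (FP.toℕ-inject₁ j) (ℕP.≰⇒> i≰j)

  onto-step≤1 : ∀ j → s (suc j) ≤ suc (s (inject₁ j))
  onto-step≤1 j with s (suc j) ≤? suc (s (inject₁ j))
  ... | yes small = small
  ... | no  gap   =
    ⊥-elim (no-value-skipped (ℕP.n<1+n _) skipped (attains _ (ℕP.<⇒≤ (ℕP.<-≤-trans skipped (bounded (suc j))))))
    where
    skipped : suc (s (inject₁ j)) < s (suc j)
    skipped = ℕP.≰⇒> gap

-- Level sequences of colourings

descents : ∀ {N} → Permutation′ (suc N) → Fin N → Bool
descents τ j = does (τ ⟨$⟩ʳ suc j <? τ ⟨$⟩ʳ inject₁ j)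

levels : ∀ {n k} → Permutation′ n → Vec (Fin k) n → Fin n → ℕ
levels τ c i = toℕ (lookup c (τ ⟨$⟩ʳ i))

inject₁<suc : ∀ {N} (j : Fin N) → inject₁ j F.< suc j
inject₁<suc j = FP.≤̄⇒inject₁< ℕP.≤-refl

does-false : ∀ {P : Set} (P? : Dec P) → does P? ≡ false → ¬ P
does-false (yes _) ()
does-false (no ¬p) _ = ¬p

ascent-at-non-descent : ∀ {N} (τ : Permutation′ (suc N)) j →
  descents τ j ≡ false → toℕ (τ ⟨$⟩ʳ inject₁ j) < toℕ (τ ⟨$⟩ʳ suc j)
ascent-at-non-descent τ j no-descent =
  FP.≤∧≢⇒< (ℕP.≮⇒≥ (does-false (τ ⟨$⟩ʳ suc j <? τ ⟨$⟩ʳ inject₁ j) no-descent))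
           (λ τj≡τj+1 → FP.<⇒≢ (inject₁<suc j) (perm-injective τ τj≡τj+1))

module _ {N K} (τ : Permutation′ (suc N)) (c : Vec (Fin (suc K)) (suc N)) where

  -- If the levels of c along τ form a staircase over the descents of τ, no
  -- sorting permutation β is lexicographically below τ: at the first
  -- difference i, the letter β(i) sits in τ at some q > i on the same level
  -- as i, and τ ascends along levels.
  staircase⇒least : Steps (descents τ) (levels τ c) → ∀ β → SortsBy c β → LexLeq τ β
  staircase⇒least st β sorts with first-difference (τ ⟨$⟩ʳ_) (β ⟨$⟩ʳ_)
  ... | inj₁ same = inj₁ same
  ... | inj₂ (i , agree , differ) = inj₂ (i , agree , subst (τ ⟨$⟩ʳ i F.<_) (inverseʳ τ) τi<τq)
    where
    q = τ ⟨$⟩ˡ (β ⟨$⟩ʳ i)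
    p = β ⟨$⟩ˡ (τ ⟨$⟩ʳ i)
    i<q : i F.< q
    i<q = later-occurrence τ β agree differ
    i<p : i F.< p
    i<p = later-occurrence β τ (λ j j<i → sym (agree j j<i)) (differ ∘ sym)
    same-level : levels τ c i ≡ levels τ c q
    same-level = ℕP.≤-antisym (steps-monotone {f = descents τ} {s = levels τ c} st i q (ℕP.<⇒≤ i<q)) (begin
      levels τ c q                ≡⟨ cong (toℕ ∘ lookup c) (inverseʳ τ) ⟩
      toℕ (lookup c (β ⟨$⟩ʳ i))   ≤⟨ sorts i p (ℕP.<⇒≤ i<p) ⟩
      toℕ (lookup c (β ⟨$⟩ʳ p))   ≡⟨ cong (toℕ ∘ lookup c) (inverseʳ β) ⟩
      levels τ c i                ∎)
      where open ℕP.≤-Reasoning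
    τi<τq : τ ⟨$⟩ʳ i F.< τ ⟨$⟩ʳ q
    τi<τq = level-ascending {f = descents τ} {s = levels τ c} (toℕ ∘ (τ ⟨$⟩ʳ_)) st
              (ascent-at-non-descent τ) i q i<q same-level

  staircase⇒alpha : Staircase N K (descents τ) (levels τ c) → InC c × IsAlpha c τ
  staircase⇒alpha (start , end , st) = onto , steps-monotone {f = descents τ} st , staircase⇒least st
    where
    onto : InC c
    onto colour with steps-surjective {f = descents τ} {s = levels τ c} st (toℕ colour)
                       (subst (_≤ toℕ colour) (sym start) z≤n)
                       (subst (toℕ colour ≤_) (sym end) (s≤s⁻¹ (FP.toℕ<n colour)))
    ... | i , e = τ ⟨$⟩ʳ i , FP.toℕ-injective e

  alpha⇒staircase : InC c → IsAlpha c τ → Staircase N K (descents τ) (levels τ c)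
  alpha⇒staircase onto isAlpha@(sorts , _) =
    onto-start sorts attains bounded , onto-end sorts attains bounded , step
    where
    attains : ∀ v → v ≤ K → ∃ λ i → levels τ c i ≡ v
    attains v v≤K =
      let (p , cₚ≡v) = onto (fromℕ< (s≤s v≤K))
      in τ ⟨$⟩ˡ p , (begin
        levels τ c (τ ⟨$⟩ˡ p)   ≡⟨ cong (toℕ ∘ lookup c) (inverseʳ τ) ⟩
        toℕ (lookup c p)        ≡⟨ cong toℕ cₚ≡v ⟩
        toℕ (fromℕ< (s≤s v≤K))  ≡⟨ FP.toℕ-fromℕ< (s≤s v≤K) ⟩
        v                       ∎)
      where open ≡-Reasoning
    bounded : ∀ i → levels τ c i ≤ K
    bounded i = s≤s⁻¹ (FP.toℕ<n (lookup c (τ ⟨$⟩ʳ i)))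
    step : Steps (descents τ) (levels τ c)
    step j with levels τ c (suc j) ℕP.≟ levels τ c (inject₁ j)
    ... | yes level = inj₁ (not-descent , level)
      where
      not-descent : descents τ j ≡ false
      not-descent = dec-false (τ ⟨$⟩ʳ suc j <? τ ⟨$⟩ʳ inject₁ j)
        (least-sorting-not-inverted c τ isAlpha (inject₁<suc j) (FP.toℕ-injective (sym level)))
    ... | no ¬level = inj₂ (ℕP.≤-antisym (onto-step≤1 sorts attains bounded j)
                              (ℕP.≤∧≢⇒< (sorts (inject₁ j) (suc j) (ℕP.<⇒≤ (inject₁<suc j))) (¬level ∘ sym)))

  staircase⇔alpha : Staircase N K (descents τ) (levels τ c) ⇔ (InC c × IsAlpha c τ)
  staircase⇔alpha = mk⇔ staircase⇒alpha (λ (onto , isAlpha) → alpha⇒staircase onto isAlpha)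

-- Transport of the count along c ↦ c ∘ τ

permute : ∀ {n} {A : Set} → Permutation′ n → Vec A n → Vec A n
permute ρ v = tabulate (λ i → lookup v (ρ ⟨$⟩ʳ i))

permute-inverse : ∀ {n} {A : Set} (ρ : Permutation′ n) (v : Vec A n) → permute (flip ρ) (permute ρ v) ≡ v
permute-inverse ρ v = begin
  tabulate (λ p → lookup (permute ρ v) (ρ ⟨$⟩ˡ p))  ≡⟨ tabulate-cong read-back ⟩
  tabulate (lookup v)                               ≡⟨ tabulate∘lookup v ⟩
  v                                                 ∎
  where
  open ≡-Reasoning
  read-back : ∀ p → lookup (permute ρ v) (ρ ⟨$⟩ˡ p) ≡ lookup v p
  read-back p = trans (lookup∘tabulate _ (ρ ⟨$⟩ˡ p)) (cong (lookup v) (inverseʳ ρ))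

HasCount-via : ∀ {A B : Set} {P : A → Set} {Q : B → Set} (g : A → B) (h : B → A) →
  (∀ a → h (g a) ≡ a) → (∀ b → g (h b) ≡ b) → (∀ a → Q (g a) ⇔ P a) →
  (ys : List B) → Unique ys → (∀ b → b ∈ ys ⇔ Q b) → HasCount P (length ys)
HasCount-via {Q = Q} g h hg≗id gh≗id Q⇔P ys unique spec =
  L.map h ys , Unique.map⁺ h-injective unique , length-map h ys , λ a → mk⇔ (sound a) (complete a)
  where
  h-injective : ∀ {b b'} → h b ≡ h b' → b ≡ b'
  h-injective {b} {b'} hb≡hb' = trans (sym (gh≗id b)) (trans (cong g hb≡hb') (gh≗id b'))
  sound : ∀ a → a ∈ L.map h ys → _
  sound a a∈ with ∈-map⁻ h a∈
  ... | b , b∈ , refl = Equivalence.to (Q⇔P (h b)) (subst Q (sym (gh≗id b)) (Equivalence.to (spec b) b∈))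
  complete : ∀ a → _ → a ∈ L.map h ys
  complete a pa = subst (_∈ L.map h ys) (hg≗id a)
    (∈-map⁺ h (Equivalence.from (spec (g a)) (Equivalence.from (Q⇔P a) pa)))

minimal-descents : ∀ {N} (π σ : Permutation′ (suc N)) →
  minimal π σ ≡ suc (countTrue (descents (σ ∘ₚ flip π)))
minimal-descents π σ =
  cong suc (length-filter-tabulate (λ j → π ⟨$⟩ˡ (σ ⟨$⟩ʳ suc j) <? π ⟨$⟩ˡ (σ ⟨$⟩ʳ inject₁ j)) id)

Solution : ∀ {n} (π σ : Permutation′ n) k → Vec (Fin k) n → Set
Solution π σ k c = InC c × ∃ λ α → IsAlpha c α × (∀ i → π ⟨$⟩ʳ (α ⟨$⟩ʳ i) ≡ σ ⟨$⟩ʳ i)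

staircase⇔solution : ∀ {N K} (π σ : Permutation′ (suc N)) (c : Vec (Fin (suc K)) (suc N)) →
  let τ = σ ∘ₚ flip π in
  Staircase N K (descents τ) (heights (permute τ c))
    ⇔ Solution π σ (suc K) c
staircase⇔solution π σ c = mk⇔
  (λ st → let (onto , isAlpha) = Equivalence.to (staircase⇔alpha τ c) (Staircase-resp read st)
          in onto , τ , isAlpha , λ i → inverseʳ π)
  (λ (onto , α , isAlpha , solves) →
     Staircase-resp (λ i → sym (read i)) (Equivalence.from (staircase⇔alpha τ c)
       (onto , IsAlpha-resp {c = c} {α = α} {α' = τ} (λ i → trans (sym (inverseˡ π)) (cong (π ⟨$⟩ˡ_) (solves i))) isAlpha)))
  where
  τ = σ ∘ₚ flip π
  read : ∀ i → heights (permute τ c) i ≡ levels τ c i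
  read i = cong toℕ (lookup∘tabulate (λ i → lookup c (τ ⟨$⟩ʳ i)) i)

lemma6p7 : (n : ℕ) (π σ : Permutation′ n) (k : ℕ) →
  minimal π σ ≤ k → k ≤ n →
  HasCount (λ (c : Vec (Fin k) n) →
              InC c × ∃ λ (α : Permutation′ n) →
                IsAlpha c α × (∀ i → π ⟨$⟩ʳ (α ⟨$⟩ʳ i) ≡ σ ⟨$⟩ʳ i))
           ((n ∸ minimal π σ) C (k ∸ minimal π σ))
lemma6p7 zero    π σ k       (s≤s _) ()
lemma6p7 (suc N) π σ zero    ()      _
lemma6p7 (suc N) π σ (suc K) m≤k     _ =
  subst (λ m → HasCount (Solution π σ (suc K)) ((suc N ∸ m) C (suc K ∸ m))) (sym (minimal-descents π σ))
    (subst (HasCount (Solution π σ (suc K))) (stairs-length (descents τ) d≤K)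
      (HasCount-via (permute τ) (permute (flip τ)) (permute-inverse τ) (permute-inverse (flip τ))
        (staircase⇔solution π σ) (stairs N K (descents τ)) stairs-unique stairs-spec))
  where
  τ = σ ∘ₚ flip π
  d≤K : countTrue (descents τ) ≤ K
  d≤K = s≤s⁻¹ (subst (_≤ suc K) (minimal-descents π σ) m≤k)
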